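{- Fix a code retrieving function $\rho$ (all triples below are w.r.t. $\rho$). Let $G$ be a reflexive state relation and assume (1) $R(P)\subseteq P$, (2) $\models\{R,P\cap C\}\,p\,\{Q,G\}$, (3) $\models\{R,P\cap\overline C\}\,q\,\{Q,G\}$, where $\overline C$ is the complement of $C$. Then $\models\{R,P\}\,\mathbf{if}\,C\,p\,q\,\{Q,G\}$.
   Context: Program terms over a state type $\alpha$ are generated by $p::=\mathbf{skip}\mid\mathbf{basic}\,f\mid\mathbf{cjump}\,C\,i\,p\mid\mathbf{while}\,C\,p\,p\mid\mathbf{if}\,C\,p\,p\mid p;p\mid\Vert(p_1,\dots,p_m)\mid\mathbf{await}\,C\,p$ ($f:\alpha\to\alpha$, $C\subseteq\alpha$, $i\in\mathbb N$, $m\ge1$). A code retrieving function $\rho$ maps $\mathbb N$ to terms. The program step relation $\rho\vdash(p,\sigma)\to_{\mathcal P}(p',\sigma')$ is the least relation with: $(\mathbf{basic}\,f,\sigma)\to(\mathbf{skip},f\sigma)$; $(\mathbf{cjump}\,C\,i\,p,\sigma)\to(\rho\,i,\sigma)$ if $\sigma\in C$, $\to(p,\sigma)$ otherwise; $(\mathbf{await}\,C\,p,\sigma)\to(\mathbf{skip},\sigma')$ if $\sigma\in C$ and $(p,\sigma)\to^*(\mathbf{skip},\sigma')$; $(\mathbf{if}\,C\,p_1\,p_2,\sigma)\to(p_1,\sigma)$ if $\sigma\in C$, $\to(p_2,\sigma)$ otherwise; for $x=\mathbf{while}\,C\,p_1\,p_2$: $(x,\sigma)\to(p_1;(\mathbf{skip};x),\sigma)$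 if $\sigma\in C$, $\to(p_2,\sigma)$ otherwise; $(p_1;p_2,\sigma)\to(p_1';p_2,\sigma')$ if $(p_1,\sigma)\to(p_1',\sigma')$; $(\mathbf{skip};p,\sigma)\to(p,\sigma)$; $(\Vert(\dots,p_i,\dots),\sigma)\to(\Vert(\dots,p_i',\dots),\sigma')$ if $(p_i,\sigma)\to(p_i',\sigma')$; $(\Vert(\mathbf{skip},\dots,\mathbf{skip}),\sigma)\to(\mathbf{skip},\sigma)$. A finite potential computation of $(\rho,p)$ is a nonempty finite sequence $(p_0,\sigma_0),\dots,(p_{n-1},\sigma_{n-1})$ with $p_0=p$ where each transition is a program step or an environment step ($p_{i+1}=p_i$, state arbitrary). For state relations $R,G\subseteq\alpha\times\alpha$ and state predicates $P,Q\subseteq\alpha$, $\models\{R,P\}\,p\,\{Q,G\}$ means: every finite potential computation of $(\rho,p)$ with $\sigma_0\in P$ and $(\sigma_i,\sigma_{i+1})\in R$ for all environment steps has $(\sigma_i,\sigma_{i+1})\in G$ for all program steps and, if some $p_i=\mathbf{skip}$, $\sigma_i\in Q$ for the least such $i$. $R(X)=\{b\mid\exists a\in X.(a,b)\in R\}$. -}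

module Defs where

open import Data.Nat using (ℕ; zero; suc)
open import Data.Fin using (Fin; inject₁; _<_)
import Data.Fin as Fin
open import Data.Vec using (Vec; _[_]≔_; lookup)
open import Data.Vec.Relation.Unary.All using (All)
open import Data.Product using (_×_; _,_)
open import Relation.Binary.PropositionalEquality using (_≡_; _≢_)
open import Relation.Nullary using (¬_)

-- Program terms over a state type α.  Predicates C ⊆ α are α → Set.
-- Parallel composition ∥(p₁,…,pₘ), m ≥ 1, is a vector of length suc m.
data Prog (α : Set) : Set₁ where
  skip  : Prog α
  basic : (α → α) → Prog α
  cjump : (α → Set) → ℕ → Prog α → Prog α
  while : (α → Set) → Prog α → Prog α → Prog α
  cond   : (α → Set) → Prog α → Prog α → Prog α
  _⨾_   : Prog α → Prog α → Prog α
  par   : {m : ℕ} → Vec (Prog α) (suc m) → Prog α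
  await : (α → Set) → Prog α → Prog α

Conf : Set → Set₁
Conf α = Prog α × α

mutual
  data Step {α : Set} (ρ : ℕ → Prog α) : Conf α → Conf α → Set₁ where
    basic-step : ∀ {f σ} → Step ρ (basic f , σ) (skip , f σ)
    cjump-t : ∀ {C i p σ} → C σ → Step ρ (cjump C i p , σ) (ρ i , σ)
    cjump-f : ∀ {C i p σ} → ¬ C σ → Step ρ (cjump C i p , σ) (p , σ)
    await-step : ∀ {C p σ σ'} → C σ → Steps ρ (p , σ) (skip , σ') →
                 Step ρ (await C p , σ) (skip , σ')
    if-t : ∀ {C p₁ p₂ σ} → C σ → Step ρ ((cond C p₁ p₂) , σ) (p₁ , σ)
    if-f : ∀ {C p₁ p₂ σ} → ¬ C σ → Step ρ ((cond C p₁ p₂) , σ) (p₂ , σ)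
    while-t : ∀ {C p₁ p₂ σ} → C σ →
              Step ρ (while C p₁ p₂ , σ) (p₁ ⨾ (skip ⨾ while C p₁ p₂) , σ)
    while-f : ∀ {C p₁ p₂ σ} → ¬ C σ → Step ρ (while C p₁ p₂ , σ) (p₂ , σ)
    seq-step : ∀ {p₁ p₁' p₂ σ σ'} → Step ρ (p₁ , σ) (p₁' , σ') →
               Step ρ (p₁ ⨾ p₂ , σ) (p₁' ⨾ p₂ , σ')
    seq-skip : ∀ {p σ} → Step ρ (skip ⨾ p , σ) (p , σ)
    par-step : ∀ {m} {ps : Vec (Prog α) (suc m)} {i : Fin (suc m)} {p' σ σ'} →
               Step ρ (lookup ps i , σ) (p' , σ') →
               Step ρ (par ps , σ) (par (ps [ i ]≔ p') , σ')
    par-skip : ∀ {m} {ps : Vec (Prog α) (suc m)} {σ} → All (_≡ skip) ps →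
               Step ρ (par ps , σ) (skip , σ)

  data Steps {α : Set} (ρ : ℕ → Prog α) : Conf α → Conf α → Set₁ where
    done : ∀ {c} → Steps ρ c c
    more : ∀ {c₁ c₂ c₃} → Step ρ c₁ c₂ → Steps ρ c₂ c₃ → Steps ρ c₁ c₃

data Label : Set where
  envL progL : Label

record Computation {α : Set} (ρ : ℕ → Prog α) (p : Prog α) : Set₁ where
  field
    n     : ℕ
    prog  : Fin (suc n) → Prog α
    state : Fin (suc n) → α
    label : Fin n → Label
    start : prog Fin.zero ≡ p
    valid-prog : ∀ i → label i ≡ progL →
      Step ρ (prog (inject₁ i) , state (inject₁ i)) (prog (Fin.suc i) , state (Fin.suc i))
    valid-env : ∀ i → label i ≡ envL → prog (Fin.suc i) ≡ prog (inject₁ i)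

Valid : {α : Set} (ρ : ℕ → Prog α) (R : α → α → Set) (P : α → Set)
        (p : Prog α) (Q : α → Set) (G : α → α → Set) → Set₁
Valid {α} ρ R P p Q G =
  (c : Computation ρ p) → let open Computation c in
  P (state Fin.zero) →
  (∀ i → label i ≡ envL → R (state (inject₁ i)) (state (Fin.suc i))) →
  (∀ i → label i ≡ progL → G (state (inject₁ i)) (state (Fin.suc i)))
  × (∀ i → prog i ≡ skip → (∀ j → j < i → prog j ≢ skip) → Q (state i))

_∩_ : {α : Set} → (α → Set) → (α → Set) → (α → Set)
(P ∩ C) σ = P σ × C σ

∁ : {α : Set} → (α → Set) → (α → Set)
∁ C σ = ¬ C σ

Stable : {α : Set} → (α → α → Set) → (α → Set) → Set
Stable R P = ∀ a b → P a → R a b → P b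

module Submission where

-- A computation of  cond C p q  starts with a (possibly empty) block of
-- environment steps, during which the program stays  cond C p q  and, by
-- stability, the state stays in P.  The first program step is a stuttering
-- step into p or q (allowed by reflexivity of G) from a state in P ∩ C,
-- resp. P ∩ ∁ C, so the rest of the computation is covered by the validity
-- of that branch.

open import Defs
open import Data.Nat using (ℕ; zero; suc; s≤s)
open import Data.Fin using (Fin; inject₁; _<_)
import Data.Fin as Fin
open import Data.Product using (_×_; _,_)
open import Data.Product.Properties using (,-injectiveˡ; ,-injectiveʳ)
open import Data.Sum using (_⊎_; inj₁; inj₂)
open import Data.Empty using (⊥-elim)
open import Relation.Binary.PropositionalEquality using (_≡_; _≢_; refl; sym; trans; subst)
open import Relation.Nullary using (¬_)

pattern 0F = Fin.zero
pattern 1F = Fin.suc Fin.zero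

module _ {α : Set} (ρ : ℕ → Prog α) where

  record Run (n : ℕ) : Set₁ where
    field
      prog  : Fin (suc n) → Prog α
      state : Fin (suc n) → α
      label : Fin n → Label
      valid-prog : ∀ i → label i ≡ progL →
        Step ρ (prog (inject₁ i) , state (inject₁ i)) (prog (Fin.suc i) , state (Fin.suc i))
      valid-env : ∀ i → label i ≡ envL → prog (Fin.suc i) ≡ prog (inject₁ i)

  open Run

  run : ∀ {p} (c : Computation ρ p) → Run (Computation.n c)
  run c = record
    { prog = Computation.prog c ; state = Computation.state c
    ; label = Computation.label c
    ; valid-prog = Computation.valid-prog c ; valid-env = Computation.valid-env c }

  computation : ∀ {n p} (r : Run n) → prog r 0F ≡ p → Computation ρ p
  computation {n} r start = record
    { n = n ; prog = prog r ; state = state r ; label = label r ; start = start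
    ; valid-prog = valid-prog r ; valid-env = valid-env r }

  tail : ∀ {n} → Run (suc n) → Run n
  tail r = record
    { prog = λ i → prog r (Fin.suc i) ; state = λ i → state r (Fin.suc i)
    ; label = λ i → label r (Fin.suc i)
    ; valid-prog = λ i → valid-prog r (Fin.suc i)
    ; valid-env = λ i → valid-env r (Fin.suc i) }

  Relies : ∀ {n} → (α → α → Set) → Run n → Set
  Relies R r = ∀ i → label r i ≡ envL → R (state r (inject₁ i)) (state r (Fin.suc i))

  Guarantees : ∀ {n} → (α → α → Set) → Run n → Set
  Guarantees G r = ∀ i → label r i ≡ progL → G (state r (inject₁ i)) (state r (Fin.suc i))

  Establishes : ∀ {n} → (α → Set) → Run n → Set₁
  Establishes Q r =
    ∀ i → prog r i ≡ skip → (∀ j → j < i → prog r j ≢ skip) → Q (state r i)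

  relies-tail : ∀ {n} R (r : Run (suc n)) → Relies R r → Relies R (tail r)
  relies-tail R r rely i = rely (Fin.suc i)

  Conclusion : ∀ {n} → (α → α → Set) → (α → Set) → Run n → Set₁
  Conclusion G Q r = Guarantees G r × Establishes Q r

  -- The conclusion extends from the tail to the whole run, provided the
  -- first step respects G (guarantees are checked step by step) and the run
  -- does not start at skip (so its first skip is the first skip of the tail).
  conclusion-cons : ∀ {n} G Q (r : Run (suc n)) →
    (label r 0F ≡ progL → G (state r 0F) (state r 1F)) → prog r 0F ≢ skip →
    Conclusion G Q (tail r) → Conclusion G Q r
  conclusion-cons G Q r first busy (rest-G , rest-Q) = guarantees , establishes
    where
    guarantees : Guarantees G r
    guarantees 0F          = first
    guarantees (Fin.suc i) = rest-G i
    establishes : Establishes Q r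
    establishes 0F          at-skip _     = ⊥-elim (busy at-skip)
    establishes (Fin.suc i) at-skip first-skip =
      rest-Q i at-skip (λ j j<i → first-skip (Fin.suc j) (s≤s j<i))

  establishes-idle : ∀ Q (r : Run 0) → prog r 0F ≢ skip → Establishes Q r
  establishes-idle Q r busy 0F at-skip _ = ⊥-elim (busy at-skip)

  stutter-into : ∀ {n b} R G P' Q → (∀ σ → G σ σ) → Valid ρ R P' b Q G →
    (r : Run (suc n)) → prog r 0F ≢ skip →
    prog r 1F ≡ b → state r 1F ≡ state r 0F → P' (state r 0F) → Relies R r →
    Conclusion G Q r
  stutter-into R G P' Q refl-G valid-b r busy enter stutter pre rely =
    conclusion-cons G Q r (λ _ → stutter-G) busy
      (valid-b (computation (tail r) enter) (subst P' (sym stutter) pre) (relies-tail R r rely))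
    where
    stutter-G : G (state r 0F) (state r 1F)
    stutter-G = subst (G (state r 0F)) (sym stutter) (refl-G (state r 0F))

  cond-step : ∀ {C p q σ c} → Step ρ (cond C p q , σ) c →
    (C σ × c ≡ (p , σ)) ⊎ (¬ C σ × c ≡ (q , σ))
  cond-step (if-t holds) = inj₁ (holds , refl)
  cond-step (if-f fails) = inj₂ (fails , refl)

module Conditional {α : Set} (ρ : ℕ → Prog α) (R G : α → α → Set) (P Q C : α → Set)
    (p q : Prog α) (refl-G : ∀ σ → G σ σ) (stable : Stable R P)
    (valid-p : Valid ρ R (P ∩ C) p Q G) (valid-q : Valid ρ R (P ∩ ∁ C) q Q G) where

  open Run

  cond-busy : ∀ {n} (r : Run ρ n) → prog r 0F ≡ cond C p q → prog r 0F ≢ skip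
  cond-busy r start at-skip with trans (sym start) at-skip
  ... | ()

  env≢prog : envL ≢ progL
  env≢prog ()

  -- Induction on the run: leading environment steps keep the program at
  -- cond C p q and, by stability, the state in P; the first program step
  -- stutters into a branch.
  cond-run : ∀ {n} (r : Run ρ n) → prog r 0F ≡ cond C p q → P (state r 0F) →
    Relies ρ R r → Conclusion ρ G Q r
  cond-run {zero} r start pre rely = (λ ()) , establishes-idle ρ Q r (cond-busy r start)
  cond-run {suc n} r start pre rely with label r 0F in first-label
  ... | envL =
    conclusion-cons ρ G Q r
      (λ is-prog → ⊥-elim (env≢prog (trans (sym first-label) is-prog))) (cond-busy r start)
      (cond-run (tail ρ r) (trans (valid-env r 0F first-label) start)
                (stable _ _ pre (rely 0F first-label)) (relies-tail ρ R r rely))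
  ... | progL
    with cond-step ρ (subst (λ b → Step ρ (b , state r 0F) (prog r 1F , state r 1F))
                            start (valid-prog r 0F first-label))
  ... | inj₁ (holds , next) =
    stutter-into ρ R G (P ∩ C) Q refl-G valid-p r (cond-busy r start)
      (,-injectiveˡ next) (,-injectiveʳ next) (pre , holds) rely
  ... | inj₂ (fails , next) =
    stutter-into ρ R G (P ∩ ∁ C) Q refl-G valid-q r (cond-busy r start)
      (,-injectiveˡ next) (,-injectiveʳ next) (pre , fails) rely

mainTheorem7 : {α : Set} (ρ : ℕ → Prog α) (R G : α → α → Set) (P Q C : α → Set) (p q : Prog α) →
    (∀ σ → G σ σ) →
    Stable R P →
    Valid ρ R (P ∩ C) p Q G →
    Valid ρ R (P ∩ ∁ C) q Q G →
    Valid ρ R P (cond C p q) Q G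
mainTheorem7 ρ R G P Q C p q refl-G stable valid-p valid-q c =
  Conditional.cond-run ρ R G P Q C p q refl-G stable valid-p valid-q
    (run ρ c) (Computation.start c)
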